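{- If $G$ is a connected graph with $c(G) = \theta(G) = k\geq 3$, then $G$ contains an induced cycle of length $4$.
   Context: All graphs are finite and simple. $\theta(G)$ is the clique cover number: the least number of cliques whose vertex sets partition $V(G)$. The Cops and Robbers game on $G$: first $m$ cops are placed on vertices, then the robber is placed; players alternate turns starting with the cops; on a turn each cop (resp. the robber) moves to an adjacent vertex or stays. The cops win if after finitely many moves a cop occupies the robber's vertex. The cop number $c(G)$ is the least $m$ such that $m$ cops can always win. -}

module Defs where

open import Data.Nat using (ℕ; _<_; _≥_)
open import Data.Fin using (Fin)
open import Data.Bool using (Bool; true; false)
open import Data.Product using (Σ; ∃; ∃-syntax; _×_; _,_)
open import Data.Sum using (_⊎_)
open import Relation.Binary.PropositionalEquality using (_≡_; _≢_)
open import Relation.Nullary using (¬_)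
open import Function.Definitions using (Surjective)

record Graph : Set where
  field
    n     : ℕ
    E     : Fin n → Fin n → Bool
    sym   : ∀ u v → E u v ≡ E v u
    irrefl : ∀ u → E u u ≡ false

module _ (G : Graph) where
  open Graph G

  Vertex : Set
  Vertex = Fin n

  Adj : Vertex → Vertex → Set
  Adj u v = E u v ≡ true

  -- u = v or u adjacent to v (a legal move from u to v: move or stay)
  Move : Vertex → Vertex → Set
  Move u v = (u ≡ v) ⊎ Adj u v

  data Walk : Vertex → Vertex → Set where
    here : ∀ {u} → Walk u u
    step : ∀ {u w v} → Adj u w → Walk w v → Walk u v

  Connected : Set
  Connected = ∀ u v → Walk u v

  -- A partition of V(G) into exactly m cliques: every vertex gets a part
  -- in Fin m, every part is nonempty (surjectivity), and each part is a clique.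
  CliqueCover : ℕ → Set
  CliqueCover m = Σ (Vertex → Fin m) λ f →
    Surjective _≡_ _≡_ f × (∀ u v → f u ≡ f v → u ≢ v → Adj u v)

  CliqueCoverNumber : ℕ → Set
  CliqueCoverNumber k = CliqueCover k × (∀ m → m < k → ¬ CliqueCover m)

  -- Cops and Robbers with m cops.
  -- CopsWinFrom c r : it is the cops' turn, cops at c, robber at r, and the
  -- cops can force a capture in finitely many moves (inductive = finite).
  data CopsWinFrom {m : ℕ} : (Fin m → Vertex) → Vertex → Set where
    caught : ∀ {c r} (i : Fin m) → c i ≡ r → CopsWinFrom c r
    move   : ∀ {c r} (c' : Fin m → Vertex) → (∀ i → Move (c i) (c' i)) →
             ((∃[ i ] c' i ≡ r) ⊎ (∀ r' → Move r r' → CopsWinFrom c' r')) →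
             CopsWinFrom c r

  CopsWin : ℕ → Set
  CopsWin m = Σ (Fin m → Vertex) λ c → ∀ r → CopsWinFrom c r

  CopNumber : ℕ → Set
  CopNumber k = CopsWin k × (∀ m → m < k → ¬ CopsWin m)

  InducedC4 : Set
  InducedC4 = Σ Vertex λ a → Σ Vertex λ b → Σ Vertex λ c → Σ Vertex λ d →
    Adj a b × Adj b c × Adj c d × Adj d a ×
    a ≢ c × b ≢ d × ¬ Adj a c × ¬ Adj b d

-- Take a partition of V(G) into k cliques. Since G is connected, some edge xy joins two of
-- them, X ∋ x and Y ∋ y. Put one cop in every clique except Y, the one in X on x. The robber
-- is caught at once unless it starts at some r ∈ Y not adjacent to x; then the X-cop steps to y,
-- which dominates Y. The robber must leave Y, and every clique but X and Y still has its cop,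
-- so it enters X at some r' not adjacent to y; but then x y r r' is an induced 4-cycle.
-- Without an induced C4, k - 1 cops therefore win, contradicting c(G) = k (only k ≥ 2 is used).
module Submission where

open import Defs
open import Data.Nat using (ℕ; suc; _≥_; s≤s)
open import Data.Nat.Properties using (n<1+n)
open import Data.Fin using (Fin; zero; suc; punchIn; punchOut; _≟_)
open import Data.Fin.Properties using (any?; 0≢1+n; punchIn-punchOut; punchOut-injective)
open import Data.Bool using (true) renaming (_≟_ to _≟ᵇ_)
open import Data.Vec.Functional using (updateAt)
open import Data.Vec.Functional.Properties using (updateAt-updates; updateAt-minimal)
open import Data.Product using (Σ; _×_; _,_; proj₁; proj₂)
open import Data.Sum using (_⊎_; inj₁; inj₂)
open import Function using (_∘_; const)
open import Function.Definitions using (Surjective)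
open import Relation.Binary.Definitions using (DecidableEquality)
open import Relation.Nullary using (¬_; Dec; yes; no; contradiction)
open import Relation.Nullary.Decidable using (_×-dec_; ¬?; decidable-stable)
open import Relation.Binary.PropositionalEquality using (_≡_; _≢_; refl; sym; trans; cong; subst)

module _ {A B : Set} {f : A → B} (onto : Surjective _≡_ _≡_ f) where

  section : B → A
  section b = proj₁ (onto b)

  section-correct : ∀ b → f (section b) ≡ b
  section-correct b = proj₂ (onto b) refl

module _ (G : Graph) where
  open Graph G using (E) renaming (sym to E-sym)

  Adj? : ∀ u v → Dec (Adj G u v)
  Adj? u v = E u v ≟ᵇ true

  Adj-sym : ∀ {u v} → Adj G u v → Adj G v u
  Adj-sym {u} {v} = trans (E-sym v u)

  InducedC4? : Dec (InducedC4 G)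
  InducedC4? = any? λ a → any? λ b → any? λ c → any? λ d →
    Adj? a b ×-dec Adj? b c ×-dec Adj? c d ×-dec Adj? d a ×-dec
    ¬? (a ≟ c) ×-dec ¬? (b ≟ d) ×-dec ¬? (Adj? a c) ×-dec ¬? (Adj? b d)

  Move⇒Adj : ∀ {u v} → Move G u v → u ≢ v → Adj G u v
  Move⇒Adj (inj₁ u≡v) u≢v = contradiction u≡v u≢v
  Move⇒Adj (inj₂ u~v) _   = u~v

  Walk⇒crossingEdge : ∀ {A : Set} → DecidableEquality A → (f : Vertex G → A) →
    ∀ {a b} → Walk G a b → f a ≢ f b →
    Σ (Vertex G) λ u → Σ (Vertex G) λ w → Adj G u w × f u ≢ f w
  Walk⇒crossingEdge _≟ᴬ_ f here fa≢fa = contradiction refl fa≢fa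
  Walk⇒crossingEdge _≟ᴬ_ f {a} (step {w = w} a~w rest) fa≢fb with f a ≟ᴬ f w
  ... | yes fa≡fw = Walk⇒crossingEdge _≟ᴬ_ f rest (fa≢fb ∘ trans fa≡fw)
  ... | no fa≢fw  = a , w , a~w , fa≢fw

  Move-updateAt : ∀ {m} (c : Fin m → Vertex G) i {u v} → c i ≡ u → Move G u v →
    ∀ j → Move G (c j) (updateAt c i (const v) j)
  Move-updateAt c i {v = v} cᵢ≡u u→v j with j ≟ i
  ... | yes refl = subst (Move G (c j)) (sym (updateAt-updates i c))
                         (subst (λ w → Move G w v) (sym cᵢ≡u) u→v)
  ... | no j≢i   = inj₁ (sym (updateAt-minimal j i c j≢i))

  Move⇒CopsWinFrom : ∀ {m} (c : Fin m → Vertex G) i {u r} → c i ≡ u → Move G u r →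
    CopsWinFrom G c r
  Move⇒CopsWinFrom c i refl (inj₁ cᵢ≡r) = caught i cᵢ≡r
  Move⇒CopsWinFrom c i refl u→r =
    move (updateAt c i (const _)) (Move-updateAt c i refl u→r) (inj₁ (i , updateAt-updates i c))

  module _ {p} (part : Vertex G → Fin p)
           (clique : ∀ u v → part u ≡ part v → u ≢ v → Adj G u v) where

    samePart⇒Move : ∀ {u v} → part u ≡ part v → Move G u v
    samePart⇒Move {u} {v} same with u ≟ v
    ... | yes u≡v = inj₁ u≡v
    ... | no u≢v  = inj₂ (clique u v same u≢v)

    inducedC4-across : ∀ {x y r r'} → Adj G x y → part x ≢ part y →
      part r ≡ part y → part r' ≡ part x → Move G r r' →
      y ≢ r → ¬ Adj G x r → ¬ Adj G y r' → InducedC4 G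
    inducedC4-across {x} {y} {r} {r'} x~y X≢Y r∈Y r'∈X r→r' y≢r x≁r y≁r' =
      x , y , r , r' , x~y , y~r , r~r' , r'~x , x≢r , y≢r' , x≁r , y≁r'
      where
      y~r : Adj G y r
      y~r = clique y r (sym r∈Y) y≢r
      r~r' : Adj G r r'
      r~r' = Move⇒Adj r→r' λ r≡r' → X≢Y (trans (sym r'∈X) (trans (cong part (sym r≡r')) r∈Y))
      r'~x : Adj G r' x
      r'~x = clique r' x r'∈X λ r'≡x → y≁r' (subst (Adj G y) (sym r'≡x) (Adj-sym x~y))
      x≢r : x ≢ r
      x≢r x≡r = X≢Y (trans (cong part x≡r) r∈Y)
      y≢r' : y ≢ r'
      y≢r' y≡r' = X≢Y (sym (trans (cong part y≡r') r'∈X))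

  module Strategy {k} (part : Vertex G → Fin (suc k)) (onto : Surjective _≡_ _≡_ part)
    (clique : ∀ u v → part u ≡ part v → u ≢ v → Adj G u v)
    {x y} (x~y : Adj G x y) (X≢Y : part x ≢ part y) (C4-free : ¬ InducedC4 G) where

    Y : Fin (suc k)
    Y = part y

    Y≢X : Y ≢ part x
    Y≢X = X≢Y ∘ sym

    Guards : (Fin k → Vertex G) → Fin k → Set
    Guards c i = part (c i) ≡ punchIn Y i

    xCop : Fin k
    xCop = punchOut Y≢X

    catchOutsideY : ∀ c {r} (Y≢R : Y ≢ part r) → Guards c (punchOut Y≢R) → CopsWinFrom G c r
    catchOutsideY c Y≢R guarded =
      Move⇒CopsWinFrom c _ refl (samePart⇒Move part clique (trans guarded (punchIn-punchOut Y≢R)))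

    afterRobberMove : ∀ c → (∀ i → i ≢ xCop → Guards c i) → c xCop ≡ y →
      ∀ {r} → part r ≡ Y → ¬ Adj G x r → y ≢ r → ∀ {r'} → Move G r r' → CopsWinFrom G c r'
    afterRobberMove c guarded cy r∈Y x≁r y≢r {r'} r→r' with Y ≟ part r'
    ... | yes Y≡R' = Move⇒CopsWinFrom c xCop cy (samePart⇒Move part clique Y≡R')
    ... | no Y≢R' with punchOut Y≢R' ≟ xCop
    ...   | no i≢xCop = catchOutsideY c Y≢R' (guarded _ i≢xCop)
    ...   | yes i≡xCop with Adj? y r'
    ...     | yes y~r' = Move⇒CopsWinFrom c xCop cy (inj₂ y~r')
    ...     | no y≁r'  = contradiction
              (inducedC4-across part clique x~y X≢Y r∈Y (punchOut-injective Y≢R' Y≢X i≡xCop)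
                                r→r' y≢r x≁r y≁r')
              C4-free

    fromStart : ∀ c → (∀ i → Guards c i) → c xCop ≡ x → ∀ r → CopsWinFrom G c r
    fromStart c guarded cx r with Y ≟ part r
    ... | no Y≢R = catchOutsideY c Y≢R (guarded _)
    ... | yes Y≡R with Adj? x r
    ...   | yes x~r = Move⇒CopsWinFrom c xCop cx (inj₂ x~r)
    ...   | no x≁r  = move c' (Move-updateAt c xCop cx (inj₂ x~y)) robberTurn
      where
      c' : Fin k → Vertex G
      c' = updateAt c xCop (const y)
      stillGuarded : ∀ i → i ≢ xCop → Guards c' i
      stillGuarded i i≢xCop = trans (cong part (updateAt-minimal i xCop c i≢xCop)) (guarded i)
      robberTurn : (Σ (Fin k) λ i → c' i ≡ r) ⊎ (∀ r' → Move G r r' → CopsWinFrom G c' r')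
      robberTurn with y ≟ r
      ... | yes y≡r = inj₁ (xCop , trans (updateAt-updates xCop c) y≡r)
      ... | no y≢r  = inj₂ λ r' →
        afterRobberMove c' stillGuarded (updateAt-updates xCop c) (sym Y≡R) x≁r y≢r

    start : Fin k → Vertex G
    start = updateAt (section onto ∘ punchIn Y) xCop (const x)

    startGuards : ∀ i → Guards start i
    startGuards i with i ≟ xCop
    ... | yes refl = trans (cong part (updateAt-updates xCop _)) (sym (punchIn-punchOut Y≢X))
    ... | no i≢xCop =
      trans (cong part (updateAt-minimal i xCop _ i≢xCop)) (section-correct onto _)

    copsWin : CopsWin G k
    copsWin = start , fromStart start startGuards (updateAt-updates xCop _)

  cliqueCover⇒CopsWin : ∀ {k} → Connected G → ¬ InducedC4 G →
    CliqueCover G (suc (suc k)) → CopsWin G (suc k)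
  cliqueCover⇒CopsWin connected C4-free (part , onto , clique) =
    let x , y , x~y , X≢Y = Walk⇒crossingEdge _≟_ part (connected v₀ v₁) distinctParts
    in Strategy.copsWin part onto clique x~y X≢Y C4-free
    where
    v₀ v₁ : Vertex G
    v₀ = section onto zero
    v₁ = section onto (suc zero)
    distinctParts : part v₀ ≢ part v₁
    distinctParts same = 0≢1+n
      (trans (sym (section-correct onto zero)) (trans same (section-correct onto (suc zero))))

lemma3p4 : (G : Graph) (k : ℕ) → Connected G → CopNumber G k →
    CliqueCoverNumber G k → k ≥ 3 → InducedC4 G
lemma3p4 G _ connected (_ , fewerCopsLose) (cover , _) (s≤s (s≤s _)) =
  decidable-stable (InducedC4? G) λ C4-free →
    fewerCopsLose _ (n<1+n _) (cliqueCover⇒CopsWin G connected C4-free cover)
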